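{- Let $w=w_1\cdots w_m$ be a reduced word of a Grassmannian permutation $\sigma$. Then $\mathrm{Tab}(w)=Q(w)$.
   Context: Words. A word $w=w_1\cdots w_m$ of positive integers is a reduced word of $\sigma=s_{w_1}\cdots s_{w_m}$ ($s_k=(k\ k{+}1)$) if $m$ equals the number of inversions of $\sigma$. With $\sigma^0=\mathrm{id}$, $\sigma^l=s_{w_1}\cdots s_{w_l}$, the one-line notation of $\sigma^l$ is obtained from that of $\sigma^{l-1}$ by exchanging the entries in positions $w_l,w_l+1$; we say $w_l$ swaps these two values. Grassmannian words and $\mathrm{Tab}$. A permutation is Grassmannian if it has exactly one descent; write it as $\sigma=a_1\cdots a_k b_1\cdots b_{n-k}$ with $a_1<\cdots<a_k$, $b_1<\cdots<b_{n-k}$, $a_k>b_1$. For a reduced word $w=w_1\cdots w_m$ of $\sigma$, each letter $w_l$ swaps some value $a_i$ with some value $b_j$; place the entry $m+1-l$ in the cell in the row indexed by $a_i$ and the column indexed by $b_j$, rows being indexed top to bottom by $a_k,a_{k-1},\dots,a_1$ and columns left to right by $b_1,\dots,b_{n-k}$. Discarding empty rows and columns, the filled cells form a Young diagram and the filling is a standard Young tableau $\mathrm{Tab}(w)$. Edelman–Greene insertion. To insert $x$ into a tableau $T$ with rows $R_1,\dots,R_k$, $R_1=r_1\le\cdots\le r_l$: if $R_1$ is empty or $x\ge r_l$, append $x$ to $R_1$; otherwise let $j$ be smallest with $x<r_j$; if $r_j=x+1$ and $r_{j-1}=x$, leave $R_1$ unchanged and insert $x+1$ into the tableau of rows $R_2,\dots,R_k$;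 otherwise replace $r_j$ by $x$ and insert $r_j$ into the tableau of rows $R_2,\dots,R_k$. For $w=w_1\cdots w_m$, insert $w_m,\dots,w_1$ successively (right to left) starting from the empty tableau; $P(w)$ is the final tableau and $Q(w)$ the standard Young tableau of the same shape whose box created at the $j$-th insertion contains $j$. -}

module Defs where

open import Data.Bool using (Bool; true; false; if_then_else_; _∧_; _∨_; not)
open import Data.Nat using (ℕ; zero; suc; _+_; _∸_; _<ᵇ_; _≡ᵇ_)
open import Data.List using (List; []; _∷_; length; map; upTo; take; drop; reverse; foldl; filterᵇ; last; _++_)
open import Data.Maybe using (Maybe; just; nothing)
open import Data.Bool.ListAction using (any)
open import Data.Product using (_×_; _,_; proj₁; proj₂)
open import Relation.Binary.PropositionalEquality using (_≡_)

-- Permutations in one-line notation (lists of values 1..n), words.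

-- exchange the entries in positions k and k+1 (positions are 1-indexed)
swapAt : ℕ → List ℕ → List ℕ
swapAt (suc zero) (x ∷ y ∷ xs) = y ∷ x ∷ xs
swapAt (suc (suc k)) (x ∷ xs) = x ∷ swapAt (suc k) xs
swapAt _ xs = xs

idPerm : ℕ → List ℕ
idPerm n = map suc (upTo n)

act : List ℕ → List ℕ → List ℕ
act σ [] = σ
act σ (k ∷ w) = act (swapAt k σ) w

-- the permutation s_{w_1} ⋯ s_{w_m} ∈ S_n in one-line notation
perm : ℕ → List ℕ → List ℕ
perm n w = act (idPerm n) w

inversions : List ℕ → ℕ
inversions [] = 0
inversions (x ∷ xs) = length (filterᵇ (λ y → y <ᵇ x) xs) + inversions xs

Reduced : ℕ → List ℕ → Set
Reduced n w = inversions (perm n w) ≡ length w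

-- the positions i (1-indexed) with σ_i > σ_{i+1}; first argument = index of head
descentsFrom : ℕ → List ℕ → List ℕ
descentsFrom i (x ∷ y ∷ xs) =
  if y <ᵇ x then i ∷ descentsFrom (suc i) (y ∷ xs) else descentsFrom (suc i) (y ∷ xs)
descentsFrom _ _ = []

descents : List ℕ → List ℕ
descents = descentsFrom 1

Grassmannian : List ℕ → Set
Grassmannian σ = length (descents σ) ≡ 1

descentPos : List ℕ → ℕ
descentPos σ with descents σ
... | k ∷ _ = k
... | [] = 0

-- 1-indexed entry of a list (0 if out of range)
nth : ℕ → List ℕ → ℕ
nth (suc zero) (x ∷ _) = x
nth (suc (suc k)) (_ ∷ xs) = nth (suc k) xs
nth _ _ = 0

-- the pair of values (σ^(l-1)_{w_l}, σ^(l-1)_{w_l+1}) swapped by each letter w_l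
swapPairs : List ℕ → List ℕ → List (ℕ × ℕ)
swapPairs σ [] = []
swapPairs σ (k ∷ w) = (nth k σ , nth (suc k) σ) ∷ swapPairs (swapAt k σ) w

elemᵇ : ℕ → List ℕ → Bool
elemᵇ x = any (λ y → x ≡ᵇ y)

-- with A = {a_1,…,a_k}: each swapped pair as (a_i , b_j)
orient : List ℕ → ℕ × ℕ → ℕ × ℕ
orient A (x , y) = if elemᵇ x A then (x , y) else (y , x)

-- the cells (row value a, column value b, entry) ; the l-th letter (1-indexed)
-- of a word of length m gives entry m + 1 - l
labelFrom : ℕ → List (ℕ × ℕ) → List (ℕ × ℕ × ℕ)
labelFrom e [] = []
labelFrom e ((a , b) ∷ ps) = (a , b , e) ∷ labelFrom (e ∸ 1) ps

-- all filled cells, indexed by values a_i (rows) and b_j (columns)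
tabCells : ℕ → List ℕ → List (ℕ × ℕ × ℕ)
tabCells n w =
  let σ = perm n w
      A = take (descentPos σ) σ
  in labelFrom (length w) (map (orient A) (swapPairs (idPerm n) w))

-- lookup in a list, 0-indexed
at : {A : Set} → List A → ℕ → Maybe A
at [] _ = nothing
at (x ∷ _) zero = just x
at (_ ∷ xs) (suc i) = at xs i

findCell : ℕ → ℕ → List (ℕ × ℕ × ℕ) → Maybe ℕ
findCell a b [] = nothing
findCell a b ((a' , b' , e) ∷ cs) =
  if (a ≡ᵇ a') ∧ (b ≡ᵇ b') then just e else findCell a b cs

-- entry of Tab(w) in row i, column j (both 0-indexed, i.e. i = 0 is the
-- top row); nothing if the cell is not in Tab(w).
-- Rows are indexed top to bottom by a_k,…,a_1 and columns left to right by
-- b_1,…,b_{n-k}, empty rows and columns being discarded.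
-- the row values (a_k,…,a_1 with empty rows discarded) and column values
-- (b_1,…,b_{n-k} with empty columns discarded)
rowVals : ℕ → List ℕ → List ℕ
rowVals n w = filterᵇ (λ a → any (λ c → a ≡ᵇ proj₁ c) (tabCells n w))
                      (reverse (take (descentPos (perm n w)) (perm n w)))

colVals : ℕ → List ℕ → List ℕ
colVals n w = filterᵇ (λ b → any (λ c → b ≡ᵇ proj₁ (proj₂ c)) (tabCells n w))
                      (drop (descentPos (perm n w)) (perm n w))

cellAt : Maybe ℕ → Maybe ℕ → List (ℕ × ℕ × ℕ) → Maybe ℕ
cellAt (just a) (just b) cs = findCell a b cs
cellAt _ _ _ = nothing

tabCell : ℕ → List ℕ → ℕ → ℕ → Maybe ℕ
tabCell n w i j = cellAt (at (rowVals n w) i) (at (colVals n w) j) (tabCells n w)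

-- Edelman–Greene insertion. Tableaux are lists of rows (top row first).

-- scanning R_1 for the smallest j with x < r_j; prev = r_{j-1} if it exists.
-- Returns the new row and the value to be inserted into the next rows.
egScan : ℕ → Maybe ℕ → List ℕ → List ℕ × Maybe ℕ
egScan x prev [] = (x ∷ [] , nothing)
egScan x prev (r ∷ rs) with x <ᵇ r
... | true with (r ≡ᵇ suc x) ∧ isPrev prev
  where isPrev : Maybe ℕ → Bool
        isPrev (just p) = p ≡ᵇ x
        isPrev nothing = false
...   | true = (r ∷ rs , just (suc x))
...   | false = (x ∷ rs , just r)
egScan x prev (r ∷ rs) | false with egScan x (just r) rs
... | (rs' , b) = (r ∷ rs' , b)

egRow : ℕ → List ℕ → List ℕ × Maybe ℕ
egRow x R with last R
... | nothing = (R ++ x ∷ [] , nothing)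
... | just rl = if x <ᵇ rl then egScan x nothing R else (R ++ x ∷ [] , nothing)

-- insert x into a tableau; also returns the (0-indexed) row where the new
-- box was created
egInsert : ℕ → List (List ℕ) → List (List ℕ) × ℕ
egInsert x [] = ((x ∷ []) ∷ [] , 0)
egInsert x (R ∷ Rs) with egRow x R
... | (R' , nothing) = (R' ∷ Rs , 0)
... | (R' , just y) with egInsert y Rs
...   | (Rs' , i) = (R' ∷ Rs' , suc i)

addBox : ℕ → ℕ → List (List ℕ) → List (List ℕ)
addBox zero e [] = (e ∷ []) ∷ []
addBox zero e (R ∷ Rs) = (R ++ e ∷ []) ∷ Rs
addBox (suc i) e [] = []
addBox (suc i) e (R ∷ Rs) = R ∷ addBox i e Rs

-- insert the letters of a list from left to right, recording (P , Q);
-- the counter is the number of insertions done so far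
egRun : ℕ → List (List ℕ) × List (List ℕ) → List ℕ → List (List ℕ) × List (List ℕ)
egRun c PQ [] = PQ
egRun c (P , Q) (x ∷ xs) with egInsert x P
... | (P' , i) = egRun (suc c) (P' , addBox i (suc c) Q) xs

-- P(w) and Q(w): insert w_m, …, w_1 starting from the empty tableau
EG : List ℕ → List (List ℕ) × List (List ℕ)
EG w = egRun 0 ([] , []) (reverse w)

Pw : List ℕ → List (List ℕ)
Pw w = proj₁ (EG w)

Qw : List ℕ → List (List ℕ)
Qw w = proj₂ (EG w)

-- entry of Q(w) in row i, column j (0-indexed); nothing if no such cell
qCell : List ℕ → ℕ → ℕ → Maybe ℕ
qCell w i j with at (Qw w) i
... | just R = at R j
... | nothing = nothing

-- Write σ = A ++ B with A = a₁ < ⋯ < a_k and B = b₁ < ⋯ < b_{n-k}.  The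
-- *pattern* of an intermediate permutation τ is the Boolean word recording
-- which entries of τ lie in A.  The proof has three ingredients.
--  1. Counting the inversions (a , b) with a ∈ A placed before b ∈ B shows
--     that every letter of a reduced word moves some a ∈ A one step to the
--     left past some b ∈ B (a "crossing word"): the count is 0 for the
--     identity, grows by at most one per letter, and equals inv(σ) = m.
--  2. A Boolean word s determines a tableau 'patternTableau s' (row r lists
--     the positions of the falses left of the r-th true from the right,
--     shifted by r).  Edelman–Greene insertion of p into the tableau of
--     s₁ true false s₂ (p = |s₁| + 1) yields the tableau of s₁ false true s₂,
--     and the new box lies in the row of a and the column of b.
--  3. Reading w from right to left, P(v) is the tableau of the pattern of
--     the permutation before v, and Q(v) holds exactly the cells of Tab(w);
--     the pattern of σ has all trues first, so its tableau is empty.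
-- Finally the nonempty rows and columns of Tab(w) form initial segments
-- (Q(w) is a Young diagram), so discarding the empty ones changes nothing.
module Submission where

open import Defs
open import Data.Bool using (Bool; true; false; _∧_; _∨_; not; if_then_else_)
open import Data.Bool.Properties using (T-≡; ∧-zeroʳ; ∨-zeroʳ)
open import Data.Bool.ListAction using (any)
open import Data.List using (List; []; _∷_; _++_; length; map; filterᵇ; reverse; last; take; drop)
open import Data.List.Properties
  using (filter-++; map-++; length-++; length-map; length-reverse; reverse-++; unfold-reverse;
         ++-assoc; ++-identityʳ; take++drop≡id; ∷-injective)
open import Data.List.Relation.Unary.All as All using (All; []; _∷_)
import Data.List.Relation.Unary.All.Properties as All
open import Data.List.Relation.Unary.AllPairs as AllPairs using (AllPairs; []; _∷_)
import Data.List.Relation.Unary.AllPairs.Properties as AllPairs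
open import Data.List.Relation.Unary.Linked using (Linked; []; [-]; _∷_)
open import Data.List.Relation.Unary.Linked.Properties using (Linked⇒AllPairs)
open import Data.List.Relation.Unary.Unique.Propositional using (Unique)
import Data.List.Relation.Unary.Unique.Propositional.Properties as Unique
open import Data.Maybe using (Maybe; just; nothing)
open import Data.Maybe.Relation.Unary.All using (just; nothing) renaming (All to MaybeAll)
open import Data.Nat using (ℕ; zero; suc; _+_; _∸_; _<_; _≤_; _<ᵇ_; _≡ᵇ_; z≤n; s≤s)
open import Data.Nat.Properties
open import Data.Nat.Solver using (module +-*-Solver)
open import Data.Product using (Σ; ∃; _×_; _,_; proj₁; proj₂)
open import Data.Sum using (_⊎_; inj₁; inj₂; map₁)
open import Function using (_∘_; id)
open import Function.Bundles using (Equivalence)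
open import Relation.Binary.PropositionalEquality
open import Relation.Nullary using (yes; no; contradiction)
open import Relation.Nullary.Decidable using (T?)

<ᵇ-true : ∀ {m n} → m < n → (m <ᵇ n) ≡ true
<ᵇ-true m<n = Equivalence.to T-≡ (<⇒<ᵇ m<n)

<ᵇ-false : ∀ {m n} → n ≤ m → (m <ᵇ n) ≡ false
<ᵇ-false {m} {n} n≤m with m <ᵇ n in eq
... | false = refl
... | true = contradiction (<ᵇ⇒< m n (Equivalence.from T-≡ eq)) (≤⇒≯ n≤m)

≡ᵇ-refl : ∀ n → (n ≡ᵇ n) ≡ true
≡ᵇ-refl n = Equivalence.to T-≡ (≡⇒≡ᵇ n n refl)

≡ᵇ-false : ∀ {m n} → m ≢ n → (m ≡ᵇ n) ≡ false
≡ᵇ-false {m} {n} m≢n with m ≡ᵇ n in eq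
... | false = refl
... | true = contradiction (≡ᵇ⇒≡ m n (Equivalence.from T-≡ eq)) m≢n

filterᵇ-accept : ∀ (p : ℕ → Bool) {x} xs → p x ≡ true → filterᵇ p (x ∷ xs) ≡ x ∷ filterᵇ p xs
filterᵇ-accept p xs px rewrite px = refl

filterᵇ-reject : ∀ (p : ℕ → Bool) {x} xs → p x ≡ false → filterᵇ p (x ∷ xs) ≡ filterᵇ p xs
filterᵇ-reject p xs px rewrite px = refl

filterᵇ-++ : ∀ (p : ℕ → Bool) xs ys → filterᵇ p (xs ++ ys) ≡ filterᵇ p xs ++ filterᵇ p ys
filterᵇ-++ p = filter-++ (T? ∘ p)

filterᵇ-all : ∀ (p : ℕ → Bool) xs → All (λ x → p x ≡ true) xs → filterᵇ p xs ≡ xs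
filterᵇ-all p [] [] = refl
filterᵇ-all p (x ∷ xs) (px ∷ pxs) = trans (filterᵇ-accept p xs px) (cong (x ∷_) (filterᵇ-all p xs pxs))

filterᵇ-none : ∀ (p : ℕ → Bool) xs → All (λ x → p x ≡ false) xs → filterᵇ p xs ≡ []
filterᵇ-none p [] [] = refl
filterᵇ-none p (x ∷ xs) (px ∷ pxs) = trans (filterᵇ-reject p xs px) (filterᵇ-none p xs pxs)

filterᵇ-ext : ∀ (p q : ℕ → Bool) xs → All (λ x → p x ≡ q x) xs → filterᵇ p xs ≡ filterᵇ q xs
filterᵇ-ext p q [] [] = refl
filterᵇ-ext p q (x ∷ xs) (e ∷ es) with p x in px
... | true = trans (cong (x ∷_) (filterᵇ-ext p q xs es)) (sym (filterᵇ-accept q xs (sym e)))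
... | false = trans (filterᵇ-ext p q xs es) (sym (filterᵇ-reject q xs (sym e)))

filterᵇ-swap : ∀ (p : ℕ → Bool) τ₁ x y τ₂ → (p x ≡ false) ⊎ (p y ≡ false) →
  filterᵇ p (τ₁ ++ x ∷ y ∷ τ₂) ≡ filterᵇ p (τ₁ ++ y ∷ x ∷ τ₂)
filterᵇ-swap p τ₁ x y τ₂ rejected
  rewrite filterᵇ-++ p τ₁ (x ∷ y ∷ τ₂) | filterᵇ-++ p τ₁ (y ∷ x ∷ τ₂) =
  cong (filterᵇ p τ₁ ++_) (middle rejected)
  where
  middle : (p x ≡ false) ⊎ (p y ≡ false) → filterᵇ p (x ∷ y ∷ τ₂) ≡ filterᵇ p (y ∷ x ∷ τ₂)
  middle (inj₁ px) rewrite px with p y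
  ... | true = cong (y ∷_) (sym (filterᵇ-reject p τ₂ px))
  ... | false = sym (filterᵇ-reject p τ₂ px)
  middle (inj₂ py) rewrite py with p x
  ... | true = cong (x ∷_) (filterᵇ-reject p τ₂ py)
  ... | false = filterᵇ-reject p τ₂ py

swapAt-split : ∀ τ₁ x y τ₂ → swapAt (suc (length τ₁)) (τ₁ ++ x ∷ y ∷ τ₂) ≡ τ₁ ++ y ∷ x ∷ τ₂
swapAt-split [] x y τ₂ = refl
swapAt-split (t ∷ τ₁) x y τ₂ = cong (t ∷_) (swapAt-split τ₁ x y τ₂)

nth-split₁ : ∀ τ₁ x y τ₂ → nth (suc (length τ₁)) (τ₁ ++ x ∷ y ∷ τ₂) ≡ x
nth-split₁ [] x y τ₂ = refl
nth-split₁ (t ∷ τ₁) x y τ₂ = nth-split₁ τ₁ x y τ₂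

nth-split₂ : ∀ τ₁ x y τ₂ → nth (suc (suc (length τ₁))) (τ₁ ++ x ∷ y ∷ τ₂) ≡ y
nth-split₂ [] x y τ₂ = refl
nth-split₂ (t ∷ τ₁) x y τ₂ = nth-split₂ τ₁ x y τ₂

AdjacentPair : ℕ → List ℕ → Set
AdjacentPair k τ = Σ (List ℕ) λ τ₁ → Σ ℕ λ x → Σ ℕ λ y → Σ (List ℕ) λ τ₂ →
  (τ ≡ τ₁ ++ x ∷ y ∷ τ₂) × (k ≡ suc (length τ₁))

swapAt-cases : ∀ k τ → (swapAt k τ ≡ τ) ⊎ AdjacentPair k τ
swapAt-cases zero τ = inj₁ refl
swapAt-cases (suc zero) [] = inj₁ refl
swapAt-cases (suc zero) (x ∷ []) = inj₁ refl
swapAt-cases (suc zero) (x ∷ y ∷ τ) = inj₂ ([] , x , y , τ , refl , refl)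
swapAt-cases (suc (suc k)) [] = inj₁ refl
swapAt-cases (suc (suc k)) (t ∷ τ) with swapAt-cases (suc k) τ
... | inj₁ eq = inj₁ (cong (t ∷_) eq)
... | inj₂ (τ₁ , x , y , τ₂ , eq , k≡) = inj₂ (t ∷ τ₁ , x , y , τ₂ , cong (t ∷_) eq , cong suc k≡)

All-swap : ∀ {P : ℕ → Set} τ₁ x y τ₂ → All P (τ₁ ++ x ∷ y ∷ τ₂) → All P (τ₁ ++ y ∷ x ∷ τ₂)
All-swap [] x y τ₂ (px ∷ py ∷ ps) = py ∷ px ∷ ps
All-swap (t ∷ τ₁) x y τ₂ (pt ∷ ps) = pt ∷ All-swap τ₁ x y τ₂ ps

Unique-swap : ∀ τ₁ x y τ₂ → Unique (τ₁ ++ x ∷ y ∷ τ₂) → Unique (τ₁ ++ y ∷ x ∷ τ₂)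
Unique-swap [] x y τ₂ ((x≢y ∷ x∉) ∷ (y∉ ∷ u)) = ((x≢y ∘ sym) ∷ y∉) ∷ (x∉ ∷ u)
Unique-swap (t ∷ τ₁) x y τ₂ (t∉ ∷ u) = All-swap τ₁ x y τ₂ t∉ ∷ Unique-swap τ₁ x y τ₂ u

Unique-act : ∀ τ v → Unique τ → Unique (act τ v)
Unique-act τ [] u = u
Unique-act τ (k ∷ v) u with swapAt-cases k τ
... | inj₁ eq rewrite eq = Unique-act τ v u
... | inj₂ (τ₁ , x , y , τ₂ , refl , refl) rewrite swapAt-split τ₁ x y τ₂ =
  Unique-act (τ₁ ++ y ∷ x ∷ τ₂) v (Unique-swap τ₁ x y τ₂ u)

idPerm-increasing : ∀ n → AllPairs _<_ (idPerm n)
idPerm-increasing n = AllPairs.map⁺ (AllPairs.applyUpTo⁺₁ id n (λ i<j _ → s≤s i<j))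

idPerm-unique : ∀ n → Unique (idPerm n)
idPerm-unique n = AllPairs.map <⇒≢ (idPerm-increasing n)

indicator : Bool → ℕ
indicator true = 1
indicator false = 0

indicator≤1 : ∀ b → indicator b ≤ 1
indicator≤1 true = ≤-refl
indicator≤1 false = z≤n

count : (ℕ → Bool) → List ℕ → ℕ
count p xs = length (filterᵇ p xs)

count-∷ : ∀ p x xs → count p (x ∷ xs) ≡ indicator (p x) + count p xs
count-∷ p x xs with p x
... | true = refl
... | false = refl

count-++ : ∀ p xs ys → count p (xs ++ ys) ≡ count p xs + count p ys
count-++ p xs ys rewrite filterᵇ-++ p xs ys = length-++ (filterᵇ p xs)

count-swap : ∀ p τ₁ x y τ₂ → count p (τ₁ ++ y ∷ x ∷ τ₂) ≡ count p (τ₁ ++ x ∷ y ∷ τ₂)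
count-swap p τ₁ x y τ₂
  rewrite count-++ p τ₁ (y ∷ x ∷ τ₂) | count-++ p τ₁ (x ∷ y ∷ τ₂)
        | count-∷ p y (x ∷ τ₂) | count-∷ p x τ₂ | count-∷ p x (y ∷ τ₂) | count-∷ p y τ₂ =
  cong (count p τ₁ +_) (+-*-Solver.solve 3 (λ a b c → a :+ (b :+ c) := b :+ (a :+ c)) refl
                          (indicator (p y)) (indicator (p x)) (count p τ₂))
  where open +-*-Solver using (_:+_; _:=_)

relatedPairs : (ℕ → ℕ → Bool) → List ℕ → ℕ
relatedPairs R [] = 0
relatedPairs R (x ∷ xs) = count (R x) xs + relatedPairs R xs

inversions-relatedPairs : ∀ xs → inversions xs ≡ relatedPairs (λ x y → y <ᵇ x) xs
inversions-relatedPairs [] = refl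
inversions-relatedPairs (x ∷ xs) = cong (count (λ y → y <ᵇ x) xs +_) (inversions-relatedPairs xs)

relatedPairs-none : ∀ R xs → AllPairs (λ x y → R x y ≡ false) xs → relatedPairs R xs ≡ 0
relatedPairs-none R [] [] = refl
relatedPairs-none R (x ∷ xs) (unrelated ∷ rest) =
  cong₂ _+_ (cong length (filterᵇ-none (R x) xs unrelated)) (relatedPairs-none R xs rest)

-- exchanging neighbours x y affects only the pair (x , y) itself
relatedPairs-swap : ∀ R τ₁ x y τ₂ →
  relatedPairs R (τ₁ ++ y ∷ x ∷ τ₂) + indicator (R x y) ≡ relatedPairs R (τ₁ ++ x ∷ y ∷ τ₂) + indicator (R y x)
relatedPairs-swap R [] x y τ₂ rewrite count-∷ (R y) x τ₂ | count-∷ (R x) y τ₂ =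
  +-*-Solver.solve 5 (λ a b c d e → ((a :+ c) :+ (d :+ e)) :+ b := ((b :+ d) :+ (c :+ e)) :+ a) refl
    (indicator (R y x)) (indicator (R x y)) (count (R y) τ₂) (count (R x) τ₂) (relatedPairs R τ₂)
  where open +-*-Solver using (_:+_; _:=_)
relatedPairs-swap R (t ∷ τ₁) x y τ₂
  rewrite count-swap (R t) τ₁ x y τ₂
        | +-assoc (count (R t) (τ₁ ++ x ∷ y ∷ τ₂)) (relatedPairs R (τ₁ ++ y ∷ x ∷ τ₂)) (indicator (R x y))
        | +-assoc (count (R t) (τ₁ ++ x ∷ y ∷ τ₂)) (relatedPairs R (τ₁ ++ x ∷ y ∷ τ₂)) (indicator (R y x)) =
  cong (count (R t) (τ₁ ++ x ∷ y ∷ τ₂) +_) (relatedPairs-swap R τ₁ x y τ₂)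

∧-true : ∀ {a b} → a ∧ b ≡ true → (a ≡ true) × (b ≡ true)
∧-true {true} {true} _ = refl , refl

not-true : ∀ {a} → not a ≡ true → a ≡ false
not-true {false} _ = refl

module Crossings (A : List ℕ) where

  inA notA : ℕ → Bool
  inA v = elemᵇ v A
  notA v = not (inA v)

  crosses : ℕ → ℕ → Bool
  crosses x y = inA x ∧ (notA y ∧ (y <ᵇ x))

  crossings : List ℕ → ℕ
  crossings = relatedPairs crosses

  CrossingStep : ℕ → List ℕ → Set
  CrossingStep k τ = Σ (List ℕ) λ τ₁ → Σ ℕ λ b → Σ ℕ λ a → Σ (List ℕ) λ τ₂ →
    (τ ≡ τ₁ ++ b ∷ a ∷ τ₂) × (k ≡ suc (length τ₁)) × (inA b ≡ false) × (inA a ≡ true)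

  data CrossingWord : List ℕ → List ℕ → Set where
    done : ∀ {τ} → CrossingWord τ []
    step : ∀ {v} τ₁ b a τ₂ → inA b ≡ false → inA a ≡ true → CrossingWord (τ₁ ++ a ∷ b ∷ τ₂) v →
           CrossingWord (τ₁ ++ b ∷ a ∷ τ₂) (suc (length τ₁) ∷ v)

  crossings-swapAt : ∀ k τ → crossings (swapAt k τ) ≤ suc (crossings τ)
    × (crossings (swapAt k τ) ≡ suc (crossings τ) → CrossingStep k τ)
  crossings-swapAt k τ with swapAt-cases k τ
  ... | inj₁ eq rewrite eq = n≤1+n _ , (λ e → contradiction (sym e) 1+n≢n)
  ... | inj₂ (τ₁ , x , y , τ₂ , refl , refl) rewrite swapAt-split τ₁ x y τ₂ = bound , tight
    where
    before after : ℕ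
    before = crossings (τ₁ ++ x ∷ y ∷ τ₂)
    after = crossings (τ₁ ++ y ∷ x ∷ τ₂)
    balance : after + indicator (crosses x y) ≡ before + indicator (crosses y x)
    balance = relatedPairs-swap crosses τ₁ x y τ₂
    bound : after ≤ suc before
    bound = begin
      after                              ≤⟨ m≤m+n after _ ⟩
      after + indicator (crosses x y)    ≡⟨ balance ⟩
      before + indicator (crosses y x)   ≤⟨ +-monoʳ-≤ before (indicator≤1 _) ⟩
      before + 1                         ≡⟨ +-comm before 1 ⟩
      suc before                         ∎
      where open ≤-Reasoning
    tight : after ≡ suc before → CrossingStep (suc (length τ₁)) (τ₁ ++ x ∷ y ∷ τ₂)
    tight grows with crosses y x in yx
    ... | true = τ₁ , x , y , τ₂ , refl , refl , not-true (proj₁ (∧-true (proj₂ (∧-true {inA y} yx)))) , proj₁ (∧-true yx)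
    ... | false = contradiction (begin
      suc before                        ≡⟨ sym grows ⟩
      after                             ≤⟨ m≤m+n after _ ⟩
      after + indicator (crosses x y)   ≡⟨ balance ⟩
      before + indicator (crosses y x)  ≡⟨ cong (λ c → before + indicator c) yx ⟩
      before + 0                        ≡⟨ +-identityʳ before ⟩
      before                            ∎) 1+n≰n
      where open ≤-Reasoning

  crossings-act : ∀ τ v → crossings (act τ v) ≤ crossings τ + length v
  crossings-act τ [] = ≤-reflexive (sym (+-identityʳ _))
  crossings-act τ (k ∷ v) = begin
    crossings (act (swapAt k τ) v)       ≤⟨ crossings-act (swapAt k τ) v ⟩
    crossings (swapAt k τ) + length v    ≤⟨ +-monoˡ-≤ (length v) (proj₁ (crossings-swapAt k τ)) ⟩
    suc (crossings τ) + length v         ≡⟨ sym (+-suc (crossings τ) (length v)) ⟩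
    crossings τ + length (k ∷ v)         ∎
    where open ≤-Reasoning

  crossingWord : ∀ τ v → crossings (act τ v) ≡ crossings τ + length v → CrossingWord τ v
  crossingWord τ [] _ = done
  crossingWord τ (k ∷ v) total = fromStep (proj₂ (crossings-swapAt k τ) first) (crossingWord (swapAt k τ) v rest)
    where
    total' : crossings (act (swapAt k τ) v) ≡ suc (crossings τ) + length v
    total' = trans total (+-suc (crossings τ) (length v))
    first : crossings (swapAt k τ) ≡ suc (crossings τ)
    first = ≤-antisym (proj₁ (crossings-swapAt k τ))
              (+-cancelʳ-≤ (length v) _ _ (≤-trans (≤-reflexive (sym total')) (crossings-act (swapAt k τ) v)))
    rest : crossings (act (swapAt k τ) v) ≡ crossings (swapAt k τ) + length v
    rest = trans total' (cong (_+ length v) (sym first))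
    fromStep : CrossingStep k τ → CrossingWord (swapAt k τ) v → CrossingWord τ (k ∷ v)
    fromStep (τ₁ , b , a , τ₂ , refl , refl , b∉ , a∈) cw =
      step τ₁ b a τ₂ b∉ a∈ (subst (λ τ' → CrossingWord τ' v) (swapAt-split τ₁ b a τ₂) cw)

  crossingWord-filter : ∀ {τ v} → CrossingWord τ v →
    (filterᵇ inA (act τ v) ≡ filterᵇ inA τ) × (filterᵇ notA (act τ v) ≡ filterᵇ notA τ)
  crossingWord-filter done = refl , refl
  crossingWord-filter (step τ₁ b a τ₂ b∉ a∈ cw) rewrite swapAt-split τ₁ b a τ₂ =
    trans (proj₁ (crossingWord-filter cw)) (filterᵇ-swap inA τ₁ a b τ₂ (inj₂ b∉)) ,
    trans (proj₂ (crossingWord-filter cw)) (filterᵇ-swap notA τ₁ a b τ₂ (inj₁ (cong not a∈)))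

  crossings-increasing : ∀ τ → AllPairs _<_ τ → crossings τ ≡ 0
  crossings-increasing τ inc = relatedPairs-none crosses τ (AllPairs.map noCross inc)
    where
    noCross : ∀ {x y} → x < y → crosses x y ≡ false
    noCross {x} {y} x<y rewrite <ᵇ-false {y} {x} (<⇒≤ x<y) | ∧-zeroʳ (notA y) = ∧-zeroʳ (inA x)

  crossings-inversions : ∀ X Y → AllPairs _≤_ X → AllPairs _≤_ Y →
    All (λ x → inA x ≡ true) X → All (λ y → inA y ≡ false) Y → crossings (X ++ Y) ≡ inversions (X ++ Y)
  crossings-inversions X Y incX incY X⊆A Y∩A = trans (go X incX X⊆A) (sym (inversions-relatedPairs (X ++ Y)))
    where
    greater : ℕ → ℕ → Bool
    greater x y = y <ᵇ x
    go : ∀ X → AllPairs _≤_ X → All (λ x → inA x ≡ true) X → crossings (X ++ Y) ≡ relatedPairs greater (X ++ Y)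
    go [] [] [] = trans (relatedPairs-none crosses Y (noneY Y Y∩A)) (sym (relatedPairs-none greater Y (AllPairs.map <ᵇ-false incY)))
      where
      noneY : ∀ Y → All (λ y → inA y ≡ false) Y → AllPairs (λ x y → crosses x y ≡ false) Y
      noneY [] [] = []
      noneY (y ∷ Y) (y∉ ∷ Y∉) = All.universal (λ z → cong (_∧ (notA z ∧ (z <ᵇ y))) y∉) Y ∷ noneY Y Y∉
    go (x ∷ X) (x≤ ∷ incX) (x∈ ∷ X⊆A) =
      cong₂ _+_ (cong length (filterᵇ-ext (crosses x) (greater x) (X ++ Y) (All.++⁺ sameX sameY))) (go X incX X⊆A)
      where
      sameX : All (λ z → crosses x z ≡ greater x z) X
      sameX = All.map (λ {z} x≤z → trans (cong (λ c → inA x ∧ (notA z ∧ c)) (<ᵇ-false x≤z))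
                (trans (cong (inA x ∧_) (∧-zeroʳ (notA z))) (trans (∧-zeroʳ (inA x)) (sym (<ᵇ-false x≤z))))) x≤
      sameY : All (λ z → crosses x z ≡ greater x z) Y
      sameY = All.map (λ {z} z∉ → cong₂ (λ a b → a ∧ (not b ∧ (z <ᵇ x))) x∈ z∉) Y∩A

≮⇒≥ᵇ : ∀ {x y} → (y <ᵇ x) ≡ false → x ≤ y
≮⇒≥ᵇ {x} {y} y≮x = ≮⇒≥ (λ y<x → contradiction (trans (sym y≮x) (<ᵇ-true y<x)) λ ())

noDescents-linked : ∀ i xs → descentsFrom i xs ≡ [] → Linked _≤_ xs
noDescents-linked i [] _ = []
noDescents-linked i (x ∷ []) _ = [-]
noDescents-linked i (x ∷ y ∷ xs) none with noDescents-linked (suc i) (y ∷ xs) | y <ᵇ x in yx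
... | _ | true = contradiction none λ ()
... | rest | false = ≮⇒≥ᵇ yx ∷ rest none

SplitAtDescent : ℕ → List ℕ → ℕ → Set
SplitAtDescent i xs k = (i ≤ k) × Linked _≤_ (take (suc (k ∸ i)) xs) × Linked _≤_ (drop (suc (k ∸ i)) xs)

∸-suc : ∀ k i → suc i ≤ k → k ∸ i ≡ suc (k ∸ suc i)
∸-suc (suc k) zero _ = refl
∸-suc (suc k) (suc i) (s≤s i<k) = ∸-suc k i i<k

oneDescent-split : ∀ i xs k → descentsFrom i xs ≡ k ∷ [] → SplitAtDescent i xs k
oneDescent-split i [] k ()
oneDescent-split i (x ∷ []) k ()
oneDescent-split i (x ∷ y ∷ xs) k one with oneDescent-split (suc i) (y ∷ xs) k | y <ᵇ x in yx
... | _ | true with ∷-injective one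
...   | (refl , none) rewrite n∸n≡0 i = ≤-refl , [-] , noDescents-linked (suc i) (y ∷ xs) none
oneDescent-split i (x ∷ y ∷ xs) k one | rest | false with rest one
... | (i<k , left , right) rewrite ∸-suc k i i<k = <⇒≤ i<k , ≮⇒≥ᵇ yx ∷ left , right

grassmannian-increasing : ∀ σ → Grassmannian σ →
  AllPairs _≤_ (take (descentPos σ) σ) × AllPairs _≤_ (drop (descentPos σ) σ)
grassmannian-increasing σ g with descents σ in eq
grassmannian-increasing σ () | []
grassmannian-increasing σ () | _ ∷ _ ∷ _
grassmannian-increasing σ g | k ∷ [] with oneDescent-split 1 σ k eq
... | (1≤k , left , right) = halves k 1≤k left right
  where
  halves : ∀ k → 1 ≤ k → Linked _≤_ (take (suc (k ∸ 1)) σ) → Linked _≤_ (drop (suc (k ∸ 1)) σ) →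
           AllPairs _≤_ (take k σ) × AllPairs _≤_ (drop k σ)
  halves (suc k) _ left right = Linked⇒AllPairs ≤-trans left , Linked⇒AllPairs ≤-trans right

rowGrowth : Maybe ℕ → ℕ
rowGrowth nothing = 1
rowGrowth (just _) = 0

egScan-growth : ∀ x prev R → length (proj₁ (egScan x prev R)) ≡ length R + rowGrowth (proj₂ (egScan x prev R))
egScan-growth x prev [] = refl
egScan-growth x prev (r ∷ rs) with x <ᵇ r
egScan-growth x prev (r ∷ rs) | true with r ≡ᵇ suc x
egScan-growth x prev (r ∷ rs) | true | false = sym (+-identityʳ _)
egScan-growth x nothing (r ∷ rs) | true | true = sym (+-identityʳ _)
egScan-growth x (just q) (r ∷ rs) | true | true with q ≡ᵇ x
... | true = sym (+-identityʳ _)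
... | false = sym (+-identityʳ _)
egScan-growth x prev (r ∷ rs) | false with egScan x (just r) rs | egScan-growth x (just r) rs
... | (rs' , _) | ih = cong suc ih

egRow-growth : ∀ x R → length (proj₁ (egRow x R)) ≡ length R + rowGrowth (proj₂ (egRow x R))
egRow-growth x R with last R
... | nothing = length-++ R
... | just l with x <ᵇ l
...   | true = egScan-growth x nothing R
...   | false = length-++ R

addToRow : ℕ → List ℕ → List ℕ
addToRow zero [] = 1 ∷ []
addToRow zero (l ∷ ls) = suc l ∷ ls
addToRow (suc i) [] = []
addToRow (suc i) (l ∷ ls) = l ∷ addToRow i ls

egInsert-shape : ∀ x P → map length (proj₁ (egInsert x P)) ≡ addToRow (proj₂ (egInsert x P)) (map length P)
egInsert-shape x [] = refl
egInsert-shape x (R ∷ Rs) with egRow x R | egRow-growth x R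
... | (R' , nothing) | grows = cong (_∷ map length Rs) (trans grows (+-comm (length R) 1))
... | (R' , just y) | same with egInsert y Rs | egInsert-shape y Rs
...   | (Rs' , i) | ih = cong₂ _∷_ (trans same (+-identityʳ _)) ih

addBox-shape : ∀ Q r e → map length (addBox r e Q) ≡ addToRow r (map length Q)
addBox-shape [] zero e = refl
addBox-shape (R ∷ Q) zero e = cong (_∷ map length Q) (trans (length-++ R) (+-comm (length R) 1))
addBox-shape [] (suc r) e = refl
addBox-shape (R ∷ Q) (suc r) e = cong (length R ∷_) (addBox-shape Q r e)

egRun-shape : ∀ c P Q xs → map length Q ≡ map length P →
  map length (proj₂ (egRun c (P , Q) xs)) ≡ map length (proj₁ (egRun c (P , Q) xs))
egRun-shape c P Q [] same = same
egRun-shape c P Q (x ∷ xs) same with egInsert x P | egInsert-shape x P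
... | (P' , i) | grown = egRun-shape (suc c) P' (addBox i (suc c) Q) xs
  (trans (addBox-shape Q i (suc c)) (trans (cong (addToRow i) same) (sym grown)))

EG-shape : ∀ v → map length (Qw v) ≡ map length (Pw v)
EG-shape v = egRun-shape 0 [] [] (reverse v) refl

insertStep : ℕ → ℕ → List (List ℕ) × List (List ℕ) → List (List ℕ) × List (List ℕ)
insertStep c x (P , Q) = proj₁ (egInsert x P) , addBox (proj₂ (egInsert x P)) (suc c) Q

egRun-snoc : ∀ c PQ xs x → egRun c PQ (xs ++ x ∷ []) ≡ insertStep (c + length xs) x (egRun c PQ xs)
egRun-snoc c (P , Q) [] x rewrite +-identityʳ c with egInsert x P
... | (P' , i) = refl
egRun-snoc c (P , Q) (y ∷ ys) x with egInsert y P
... | (P' , i) rewrite +-suc c (length ys) = egRun-snoc (suc c) (P' , addBox i (suc c) Q) ys x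

EG-∷ : ∀ x v → EG (x ∷ v) ≡ insertStep (length v) x (EG v)
EG-∷ x v rewrite unfold-reverse x v | egRun-snoc 0 ([] , []) (reverse v) x | length-reverse v = refl

last-++ : ∀ (xs : List ℕ) z zs → last (xs ++ z ∷ zs) ≡ last (z ∷ zs)
last-++ [] z zs = refl
last-++ (x ∷ []) z zs = refl
last-++ (x ∷ x' ∷ xs) z zs = last-++ (x' ∷ xs) z zs

last-All : ∀ {P : ℕ → Set} z zs {l} → All P (z ∷ zs) → last (z ∷ zs) ≡ just l → P l
last-All z [] (pz ∷ _) refl = pz
last-All z (z' ∷ zs) (_ ∷ ps) eq = last-All z' zs ps eq

egRow-append : ∀ x R → All (_< x) R → egRow x R ≡ (R ++ x ∷ [] , nothing)
egRow-append x [] _ = refl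
egRow-append x (r ∷ R) R<x with last (r ∷ R) in eq
... | just l rewrite <ᵇ-false (<⇒≤ (last-All r R R<x eq)) = refl
... | nothing = refl

-- scanning past entries below y reaches y + 1, which is bumped since the previous entry is not y
egScan-bump : ∀ y prev xs ys → All (_< y) xs → MaybeAll (_< y) prev →
  egScan y prev (xs ++ suc y ∷ ys) ≡ (xs ++ y ∷ ys , just (suc y))
egScan-bump y nothing [] ys [] nothing rewrite <ᵇ-true (n<1+n y) | ≡ᵇ-refl y = refl
egScan-bump y (just z) [] ys [] (just z<y) rewrite <ᵇ-true (n<1+n y) | ≡ᵇ-refl y | ≡ᵇ-false (<⇒≢ z<y) = refl
egScan-bump y prev (x ∷ xs) ys (x<y ∷ xs<y) _
  rewrite <ᵇ-false (<⇒≤ x<y) | egScan-bump y (just x) xs ys xs<y (just x<y) = refl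

egRow-bump : ∀ y xs ys → All (_< y) xs → All (suc y ≤_) ys →
  egRow y (xs ++ suc y ∷ ys) ≡ (xs ++ y ∷ ys , just (suc y))
egRow-bump y xs ys xs<y ys>y with last (xs ++ suc y ∷ ys) in eq
... | just l rewrite <ᵇ-true (last-All (suc y) ys (≤-refl ∷ ys>y) (trans (sym (last-++ xs (suc y) ys)) eq)) =
  egScan-bump y nothing xs ys xs<y nothing
... | nothing = contradiction (trans (sym (last-++ xs (suc y) ys)) eq) (nonempty (suc y) ys)
  where
  nonempty : ∀ z zs → last (z ∷ zs) ≢ nothing
  nonempty z [] ()
  nonempty z (z' ∷ zs) = nonempty z' zs

egInsert-bump : ∀ x R Rs R' y → egRow x R ≡ (R' , just y) →
  egInsert x (R ∷ Rs) ≡ (R' ∷ proj₁ (egInsert y Rs) , suc (proj₂ (egInsert y Rs)))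
egInsert-bump x R Rs R' y eq rewrite eq with egInsert y Rs
... | (Rs' , i) = refl

egInsert-append : ∀ x R Rs R' → egRow x R ≡ (R' , nothing) → egInsert x (R ∷ Rs) ≡ (R' ∷ Rs , 0)
egInsert-append x R Rs R' eq rewrite eq = refl

truePositions falsePositions : ℕ → List Bool → List ℕ
truePositions o [] = []
truePositions o (true ∷ s) = o ∷ truePositions (suc o) s
truePositions o (false ∷ s) = truePositions (suc o) s
falsePositions o [] = []
falsePositions o (true ∷ s) = falsePositions (suc o) s
falsePositions o (false ∷ s) = o ∷ falsePositions (suc o) s

below : ℕ → ℕ → Bool
below q f = f <ᵇ q

-- a row with entries shifted by r; an empty row ends the tableau
shiftedRow : ℕ → List ℕ → List (List ℕ) → List (List ℕ)
shiftedRow r [] rest = []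
shiftedRow r (f ∷ fs) rest = map (_+ r) (f ∷ fs) ∷ rest

rowsBelow : ℕ → List ℕ → List ℕ → List (List ℕ)
rowsBelow r F [] = []
rowsBelow r F (q ∷ Q) = shiftedRow r (filterᵇ (below q) F) (rowsBelow (suc r) F Q)

patternTableau : List Bool → List (List ℕ)
patternTableau s = rowsBelow 0 (falsePositions 1 s) (reverse (truePositions 1 s))

shiftedRow-nonempty : ∀ r ys z zs rest → shiftedRow r (ys ++ z ∷ zs) rest ≡ map (_+ r) (ys ++ z ∷ zs) ∷ rest
shiftedRow-nonempty r [] z zs rest = refl
shiftedRow-nonempty r (y ∷ ys) z zs rest = refl

rowsBelow-cong : ∀ r F F' Q → All (λ q → filterᵇ (below q) F ≡ filterᵇ (below q) F') Q → rowsBelow r F Q ≡ rowsBelow r F' Q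
rowsBelow-cong r F F' [] [] = refl
rowsBelow-cong r F F' (q ∷ Q) (same ∷ rest) rewrite same | rowsBelow-cong (suc r) F F' Q rest = refl

rowsBelow-empty : ∀ r F Q → All (λ q → filterᵇ (below q) F ≡ []) Q → rowsBelow r F Q ≡ []
rowsBelow-empty r F [] [] = refl
rowsBelow-empty r F (q ∷ Q) (empty ∷ _) rewrite empty = refl

rowsBelow-nonempty : ∀ r F Q → All (0 <_) (map length (rowsBelow r F Q))
rowsBelow-nonempty r F [] = []
rowsBelow-nonempty r F (q ∷ Q) = firstRow (filterᵇ (below q) F)
  where
  firstRow : ∀ xs → All (0 <_) (map length (shiftedRow r xs (rowsBelow (suc r) F Q)))
  firstRow [] = []
  firstRow (x ∷ xs) = s≤s z≤n ∷ rowsBelow-nonempty (suc r) F Q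

below-all : ∀ q xs → All (_< q) xs → filterᵇ (below q) xs ≡ xs
below-all q xs xs<q = filterᵇ-all (below q) xs (All.map <ᵇ-true xs<q)

below-none : ∀ q xs → All (q ≤_) xs → filterᵇ (below q) xs ≡ []
below-none q xs xs≥q = filterᵇ-none (below q) xs (All.map <ᵇ-false xs≥q)

below-middle : ∀ q lo x hi → All (_< q) lo → x < q →
  filterᵇ (below q) (lo ++ x ∷ hi) ≡ lo ++ x ∷ filterᵇ (below q) hi
below-middle q lo x hi lo<q x<q
  rewrite filterᵇ-++ (below q) lo (x ∷ hi) | below-all q lo lo<q | filterᵇ-accept (below q) hi (<ᵇ-true x<q) = refl

below-prefix : ∀ q lo x hi → q ≤ x → All (q ≤_) hi → filterᵇ (below q) (lo ++ x ∷ hi) ≡ filterᵇ (below q) lo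
below-prefix q lo x hi q≤x hi≥q
  rewrite filterᵇ-++ (below q) lo (x ∷ hi) | filterᵇ-reject (below q) hi (<ᵇ-false q≤x) | below-none q hi hi≥q =
  ++-identityʳ _

BoxSlot : List ℕ → ℕ → ℕ → Set
BoxSlot L i c = (at L i ≡ just c) ⊎ (length L ≡ i × c ≡ 0)

-- Insertion of p + r when the falses contain p + 1 but not p and the bounds contain p but
-- not p + 1: in each row whose bound exceeds p + 1, the entry p + r replaces p + 1 + r,
-- which moves on to the next row as p + (r + 1); in the row of bound p it is appended.
-- Afterwards p and p + 1 have exchanged their roles.
module ExchangeInsertion (p : ℕ) (lo hi Qlo : List ℕ)
  (lo<p : All (_< p) lo) (hi>p+1 : All (suc p <_) hi) (Qlo<p : All (_< p) Qlo) where

  high-row : ∀ q x r rest → suc p < q → x ≤ suc p →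
    shiftedRow r (filterᵇ (below q) (lo ++ x ∷ hi)) rest
      ≡ (map (_+ r) lo ++ (x + r) ∷ map (_+ r) (filterᵇ (below q) hi)) ∷ rest
  high-row q x r rest q>p+1 x≤p+1
    rewrite below-middle q lo x hi (All.map (λ l<p → <-trans l<p (≤-<-trans (n≤1+n p) q>p+1)) lo<p) (≤-<-trans x≤p+1 q>p+1)
          | shiftedRow-nonempty r lo x (filterᵇ (below q) hi) rest = cong (_∷ rest) (map-++ (_+ r) lo _)

  -- rows with bound below p do not see x ≥ p nor hi
  low-rows : ∀ r L x → p ≤ x → rowsBelow r (L ++ x ∷ hi) Qlo ≡ rowsBelow r L Qlo
  low-rows r L x p≤x = rowsBelow-cong r _ L Qlo (All.map (λ {q} q<p → below-prefix q L x hi (≤-trans (<⇒≤ q<p) p≤x)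
    (All.map (λ h → <⇒≤ (<-trans q<p (<-trans (n<1+n p) h))) hi>p+1)) Qlo<p)

  lowest-row : (filterᵇ (below p) (lo ++ suc p ∷ hi) ≡ lo) × (filterᵇ (below (suc p)) (lo ++ p ∷ hi) ≡ lo ++ p ∷ [])
  lowest-row = trans (below-prefix p lo (suc p) hi (n≤1+n p) (All.map (λ h → <⇒≤ (<-trans (n<1+n p) h)) hi>p+1)) (below-all p lo lo<p)
    , trans (below-middle (suc p) lo p hi (All.map (λ h → <-trans h (n<1+n p)) lo<p) (n<1+n p))
            (cong (λ t → lo ++ p ∷ t) (below-none (suc p) hi (All.map <⇒≤ hi>p+1)))

  append-row : ∀ r L → All (_< p) L → egInsert (p + r) (shiftedRow r L (rowsBelow (suc r) L Qlo))
                 ≡ (shiftedRow r (L ++ p ∷ []) (rowsBelow (suc r) L Qlo) , 0)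
  append-row r [] _ = cong (λ rest → ((p + r ∷ []) ∷ rest , 0))
    (sym (rowsBelow-empty (suc r) [] Qlo (All.universal (λ _ → refl) Qlo)))
  append-row r (l ∷ L) L<p
    rewrite egInsert-append (p + r) (map (_+ r) (l ∷ L)) (rowsBelow (suc r) (l ∷ L) Qlo) _
              (egRow-append (p + r) (map (_+ r) (l ∷ L)) (All.map⁺ (All.map (+-monoˡ-< r) L<p)))
          | map-++ (_+ r) (l ∷ L) (p ∷ []) = refl

  insert-rows : ∀ Qhi r → All (suc p <_) Qhi →
    egInsert (p + r) (rowsBelow r (lo ++ suc p ∷ hi) (Qhi ++ p ∷ Qlo))
      ≡ (rowsBelow r (lo ++ p ∷ hi) (Qhi ++ suc p ∷ Qlo) , length Qhi)
  insert-rows (q ∷ Qhi) r (q>p+1 ∷ Qhi>p+1) = begin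
    egInsert (p + r) (rowsBelow r (lo ++ suc p ∷ hi) (q ∷ Qhi ++ p ∷ Qlo))
      ≡⟨ cong (egInsert (p + r)) (high-row q (suc p) r rest q>p+1 ≤-refl) ⟩
    egInsert (p + r) ((lo' ++ suc (p + r) ∷ H) ∷ rest)
      ≡⟨ egInsert-bump (p + r) (lo' ++ suc (p + r) ∷ H) rest (lo' ++ p + r ∷ H) (suc (p + r)) (egRow-bump (p + r) lo' H lo'<p+r H>p+r) ⟩
    ((lo' ++ p + r ∷ H) ∷ proj₁ (egInsert (suc (p + r)) rest) , suc (proj₂ (egInsert (suc (p + r)) rest)))
      ≡⟨ cong (λ z → ((lo' ++ p + r ∷ H) ∷ proj₁ z , suc (proj₂ z)))
           (trans (cong (λ y → egInsert y rest) (sym (+-suc p r))) (insert-rows Qhi (suc r) Qhi>p+1)) ⟩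
    ((lo' ++ p + r ∷ H) ∷ rowsBelow (suc r) (lo ++ p ∷ hi) (Qhi ++ suc p ∷ Qlo) , suc (length Qhi))
      ≡⟨ cong (_, suc (length Qhi)) (sym (high-row q p r _ q>p+1 (n≤1+n p))) ⟩
    (rowsBelow r (lo ++ p ∷ hi) (q ∷ Qhi ++ suc p ∷ Qlo) , length (q ∷ Qhi)) ∎
    where
    open ≡-Reasoning
    lo' H : List ℕ
    lo' = map (_+ r) lo
    H = map (_+ r) (filterᵇ (below q) hi)
    rest : List (List ℕ)
    rest = rowsBelow (suc r) (lo ++ suc p ∷ hi) (Qhi ++ p ∷ Qlo)
    lo'<p+r : All (_< p + r) lo'
    lo'<p+r = All.map⁺ (All.map (+-monoˡ-< r) lo<p)
    H>p+r : All (suc (p + r) ≤_) H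
    H>p+r = All.map⁺ (All.map (+-monoˡ-≤ r ∘ <⇒≤) (All.filter⁺ (T? ∘ below q) hi>p+1))
  insert-rows [] r []
    rewrite proj₁ (lowest-row) | proj₂ (lowest-row)
          | low-rows (suc r) lo (suc p) (n≤1+n p) | low-rows (suc r) lo p ≤-refl = append-row r lo lo<p

  new-box : ∀ Qhi r → All (suc p <_) Qhi →
    BoxSlot (map length (rowsBelow r (lo ++ suc p ∷ hi) (Qhi ++ p ∷ Qlo))) (length Qhi) (length lo)
  new-box (q ∷ Qhi) r (q>p+1 ∷ Qhi>p+1)
    rewrite high-row q (suc p) r (rowsBelow (suc r) (lo ++ suc p ∷ hi) (Qhi ++ p ∷ Qlo)) q>p+1 ≤-refl
    with new-box Qhi (suc r) Qhi>p+1
  ... | inj₁ found = inj₁ found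
  ... | inj₂ (rows , empty) = inj₂ (cong suc rows , empty)
  new-box [] r [] rewrite proj₁ (lowest-row) = firstRow lo
    where
    firstRow : ∀ L → BoxSlot (map length (shiftedRow r L (rowsBelow (suc r) (L ++ suc p ∷ hi) Qlo))) 0 (length L)
    firstRow [] = inj₂ (refl , refl)
    firstRow (l ∷ L) = inj₁ (cong just (length-map (_+ r) (l ∷ L)))

truePositions-++ : ∀ o s₁ s₂ → truePositions o (s₁ ++ s₂) ≡ truePositions o s₁ ++ truePositions (o + length s₁) s₂
truePositions-++ o [] s₂ rewrite +-identityʳ o = refl
truePositions-++ o (true ∷ s₁) s₂ rewrite +-suc o (length s₁) = cong (o ∷_) (truePositions-++ (suc o) s₁ s₂)
truePositions-++ o (false ∷ s₁) s₂ rewrite +-suc o (length s₁) = truePositions-++ (suc o) s₁ s₂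

falsePositions-++ : ∀ o s₁ s₂ → falsePositions o (s₁ ++ s₂) ≡ falsePositions o s₁ ++ falsePositions (o + length s₁) s₂
falsePositions-++ o [] s₂ rewrite +-identityʳ o = refl
falsePositions-++ o (true ∷ s₁) s₂ rewrite +-suc o (length s₁) = falsePositions-++ (suc o) s₁ s₂
falsePositions-++ o (false ∷ s₁) s₂ rewrite +-suc o (length s₁) = cong (o ∷_) (falsePositions-++ (suc o) s₁ s₂)

truePositions-≥ : ∀ o s → All (o ≤_) (truePositions o s)
truePositions-≥ o [] = []
truePositions-≥ o (true ∷ s) = ≤-refl ∷ All.map <⇒≤ (truePositions-≥ (suc o) s)
truePositions-≥ o (false ∷ s) = All.map <⇒≤ (truePositions-≥ (suc o) s)

falsePositions-≥ : ∀ o s → All (o ≤_) (falsePositions o s)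
falsePositions-≥ o [] = []
falsePositions-≥ o (true ∷ s) = All.map <⇒≤ (falsePositions-≥ (suc o) s)
falsePositions-≥ o (false ∷ s) = ≤-refl ∷ All.map <⇒≤ (falsePositions-≥ (suc o) s)

truePositions-< : ∀ o s → All (_< o + length s) (truePositions o s)
truePositions-< o [] = []
truePositions-< o (true ∷ s) rewrite +-suc o (length s) = s≤s (m≤m+n o (length s)) ∷ truePositions-< (suc o) s
truePositions-< o (false ∷ s) rewrite +-suc o (length s) = truePositions-< (suc o) s

falsePositions-< : ∀ o s → All (_< o + length s) (falsePositions o s)
falsePositions-< o [] = []
falsePositions-< o (true ∷ s) rewrite +-suc o (length s) = falsePositions-< (suc o) s
falsePositions-< o (false ∷ s) rewrite +-suc o (length s) = s≤s (m≤m+n o (length s)) ∷ falsePositions-< (suc o) s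

length-truePositions : ∀ o (q : ℕ → Bool) xs → length (truePositions o (map q xs)) ≡ length (filterᵇ q xs)
length-truePositions o q [] = refl
length-truePositions o q (x ∷ xs) with q x
... | true = cong suc (length-truePositions (suc o) q xs)
... | false = length-truePositions (suc o) q xs

length-falsePositions : ∀ o (q : ℕ → Bool) xs → length (falsePositions o (map q xs)) ≡ length (filterᵇ (not ∘ q) xs)
length-falsePositions o q [] = refl
length-falsePositions o q (x ∷ xs) with q x
... | true = length-falsePositions (suc o) q xs
... | false = cong suc (length-falsePositions (suc o) q xs)

All-reverse : ∀ {P : ℕ → Set} xs → All P xs → All P (reverse xs)
All-reverse [] [] = []
All-reverse (x ∷ xs) (px ∷ pxs) rewrite unfold-reverse x xs = All.∷ʳ⁺ (All-reverse xs pxs) px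

reverse-middle : ∀ (X : List ℕ) y Y → reverse (X ++ y ∷ Y) ≡ reverse Y ++ y ∷ reverse X
reverse-middle X y Y rewrite reverse-++ X (y ∷ Y) | unfold-reverse y Y = ++-assoc (reverse Y) (y ∷ []) (reverse X)

-- exchanging "true false" at positions p, p + 1 of a word is one insertion of p
module Exchange (s₁ s₂ : List Bool) where
  p : ℕ
  p = suc (length s₁)
  lo hi Qhi Qlo : List ℕ
  lo = falsePositions 1 s₁
  hi = falsePositions (suc (suc p)) s₂
  Qhi = reverse (truePositions (suc (suc p)) s₂)
  Qlo = reverse (truePositions 1 s₁)

  open ExchangeInsertion p lo hi Qlo (falsePositions-< 1 s₁) (falsePositions-≥ _ s₂) (All-reverse _ (truePositions-< 1 s₁))

  before : patternTableau (s₁ ++ true ∷ false ∷ s₂) ≡ rowsBelow 0 (lo ++ suc p ∷ hi) (Qhi ++ p ∷ Qlo)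
  before rewrite falsePositions-++ 1 s₁ (true ∷ false ∷ s₂) | truePositions-++ 1 s₁ (true ∷ false ∷ s₂)
               | reverse-middle (truePositions 1 s₁) p (truePositions (suc (suc p)) s₂) = refl

  after : patternTableau (s₁ ++ false ∷ true ∷ s₂) ≡ rowsBelow 0 (lo ++ p ∷ hi) (Qhi ++ suc p ∷ Qlo)
  after rewrite falsePositions-++ 1 s₁ (false ∷ true ∷ s₂) | truePositions-++ 1 s₁ (false ∷ true ∷ s₂)
              | reverse-middle (truePositions 1 s₁) (suc p) (truePositions (suc (suc p)) s₂) = refl

  Qhi>p+1 : All (suc p <_) Qhi
  Qhi>p+1 = All-reverse _ (truePositions-≥ _ s₂)

  exchange-insert : egInsert p (patternTableau (s₁ ++ true ∷ false ∷ s₂)) ≡ (patternTableau (s₁ ++ false ∷ true ∷ s₂) , length Qhi)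
  exchange-insert rewrite before | after =
    subst (λ x → egInsert x (rowsBelow 0 (lo ++ suc p ∷ hi) (Qhi ++ p ∷ Qlo))
                   ≡ (rowsBelow 0 (lo ++ p ∷ hi) (Qhi ++ suc p ∷ Qlo) , length Qhi))
          (+-identityʳ p) (insert-rows Qhi 0 Qhi>p+1)

  exchange-box : BoxSlot (map length (patternTableau (s₁ ++ true ∷ false ∷ s₂))) (length Qhi) (length lo)
  exchange-box rewrite before = new-box Qhi 0 Qhi>p+1

falsePositions-allTrue : ∀ o s → All (_≡ true) s → falsePositions o s ≡ []
falsePositions-allTrue o [] [] = refl
falsePositions-allTrue o (true ∷ s) (_ ∷ t) = falsePositions-allTrue (suc o) s t

truePositions-allFalse : ∀ o s → All (_≡ false) s → truePositions o s ≡ []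
truePositions-allFalse o [] [] = refl
truePositions-allFalse o (false ∷ s) (_ ∷ f) = truePositions-allFalse (suc o) s f

patternTableau-sorted : ∀ s₁ s₂ → All (_≡ true) s₁ → All (_≡ false) s₂ → patternTableau (s₁ ++ s₂) ≡ []
patternTableau-sorted s₁ s₂ trues falses
  rewrite falsePositions-++ 1 s₁ s₂ | truePositions-++ 1 s₁ s₂
        | falsePositions-allTrue 1 s₁ trues | truePositions-allFalse (suc (length s₁)) s₂ falses
        | ++-identityʳ (truePositions 1 s₁) =
  rowsBelow-empty 0 _ _ (All-reverse _ (All.map (λ {q} q<o → below-none q _
    (All.map (≤-trans (<⇒≤ q<o)) (falsePositions-≥ (suc (length s₁)) s₂))) (truePositions-< 1 s₁)))

entry : List (List ℕ) → ℕ → ℕ → Maybe ℕ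
entry T i j with at T i
... | just R = at R j
... | nothing = nothing

qCell-entry : ∀ w i j → qCell w i j ≡ entry (Qw w) i j
qCell-entry w i j with at (Qw w) i
... | just R = refl
... | nothing = refl

Filled : Maybe ℕ → Set
Filled m = ∃ λ x → m ≡ just x

at-++-length : ∀ {X : Set} (xs : List X) y ys → at (xs ++ y ∷ ys) (length xs) ≡ just y
at-++-length [] y ys = refl
at-++-length (x ∷ xs) y ys = at-++-length xs y ys

at-snoc-other : ∀ (R : List ℕ) e j → j ≢ length R → at (R ++ e ∷ []) j ≡ at R j
at-snoc-other [] e zero j≢ = contradiction refl j≢
at-snoc-other [] e (suc j) j≢ = refl
at-snoc-other (x ∷ R) e zero j≢ = refl
at-snoc-other (x ∷ R) e (suc j) j≢ = at-snoc-other R e j (j≢ ∘ cong suc)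

at-All : ∀ {P : ℕ → Set} L j x → All P L → at L j ≡ just x → P x
at-All (y ∷ L) zero x (py ∷ _) refl = py
at-All (y ∷ L) (suc j) x (_ ∷ ps) eq = at-All L j x ps eq

at-injective : ∀ L i j x → Unique L → at L i ≡ just x → at L j ≡ just x → i ≡ j
at-injective (y ∷ L) zero zero x _ _ _ = refl
at-injective (y ∷ L) zero (suc j) x (y∉ ∷ _) refl eq = contradiction refl (at-All L j y y∉ eq)
at-injective (y ∷ L) (suc i) zero x (y∉ ∷ _) eq refl = contradiction refl (at-All L i y y∉ eq)
at-injective (y ∷ L) (suc i) (suc j) x (_ ∷ u) eq₁ eq₂ = cong suc (at-injective L i j x u eq₁ eq₂)

at-length : ∀ {X : Set} (R : List X) j x → at R j ≡ just x → j < length R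
at-length (r ∷ R) zero x _ = s≤s z≤n
at-length (r ∷ R) (suc j) x eq = s≤s (at-length R j x eq)

length-at : ∀ {X : Set} (R : List X) j → j < length R → ∃ λ x → at R j ≡ just x
length-at (r ∷ R) zero _ = r , refl
length-at (r ∷ R) (suc j) (s≤s j<) = length-at R j j<

addBox-new : ∀ Q r c e → BoxSlot (map length Q) r c → entry (addBox r e Q) r c ≡ just e
addBox-new [] zero c e (inj₂ (_ , refl)) = refl
addBox-new [] (suc r) c e (inj₂ (() , _))
addBox-new (R ∷ Q) zero c e (inj₁ refl) = at-++-length R e []
addBox-new (R ∷ Q) zero c e (inj₂ (() , _))
addBox-new (R ∷ Q) (suc r) c e (inj₁ slot) = addBox-new Q r c e (inj₁ slot)
addBox-new (R ∷ Q) (suc r) c e (inj₂ (rows , c≡0)) = addBox-new Q r c e (inj₂ (suc-injective rows , c≡0))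

addBox-old : ∀ Q r c e i j → BoxSlot (map length Q) r c → (i ≢ r ⊎ j ≢ c) → entry (addBox r e Q) i j ≡ entry Q i j
addBox-old [] zero c e zero j (inj₂ (_ , refl)) (inj₁ i≢) = contradiction refl i≢
addBox-old [] zero c e zero zero (inj₂ (_ , refl)) (inj₂ j≢) = contradiction refl j≢
addBox-old [] zero c e zero (suc j) (inj₂ (_ , refl)) (inj₂ _) = refl
addBox-old [] zero c e (suc i) j _ _ = refl
addBox-old [] (suc r) c e i j _ _ = refl
addBox-old (R ∷ Q) zero c e zero j (inj₁ refl) (inj₁ i≢) = contradiction refl i≢
addBox-old (R ∷ Q) zero c e zero j (inj₁ refl) (inj₂ j≢) = at-snoc-other R e j j≢
addBox-old (R ∷ Q) zero c e zero j (inj₂ (() , _)) _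
addBox-old (R ∷ Q) zero c e (suc i) j _ _ = refl
addBox-old (R ∷ Q) (suc r) c e zero j _ _ = refl
addBox-old (R ∷ Q) (suc r) c e (suc i) j slot other =
  addBox-old Q r c e i j (tail slot) (map₁ (_∘ cong suc) other)
  where
  tail : BoxSlot (map length (R ∷ Q)) (suc r) c → BoxSlot (map length Q) r c
  tail (inj₁ found) = inj₁ found
  tail (inj₂ (rows , c≡0)) = inj₂ (suc-injective rows , c≡0)

filled-left : ∀ Q i j j' → Filled (entry Q i j) → j' ≤ j → Filled (entry Q i j')
filled-left Q i j j' (x , eq) j'≤j with at Q i
... | just R = length-at R j' (≤-<-trans j'≤j (at-length R j x eq))

filled-up : ∀ Q i j i' → All (0 <_) (map length Q) → Filled (entry Q i j) → i' ≤ i → Filled (entry Q i' 0)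
filled-up Q i j i' nonempty (x , eq) i'≤i with at Q i in row
... | just R with length-at Q i' (≤-<-trans i'≤i (at-length Q i R row))
...   | (R' , row') rewrite row' = length-at R' 0 (at-All (map length Q) i' (length R') nonempty (at-map Q i' R' row'))
  where
  at-map : ∀ Q i R → at Q i ≡ just R → at (map length Q) i ≡ just (length R)
  at-map (R ∷ Q) zero R' refl = refl
  at-map (R ∷ Q) (suc i) R' eq = at-map Q i R' eq

cellAt-[] : ∀ ma mb → cellAt ma mb [] ≡ nothing
cellAt-[] (just a) (just b) = refl
cellAt-[] (just a) nothing = refl
cellAt-[] nothing mb = refl

cellAt-here : ∀ a b e cs → cellAt (just a) (just b) ((a , b , e) ∷ cs) ≡ just e
cellAt-here a b e cs rewrite ≡ᵇ-refl a | ≡ᵇ-refl b = refl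

cellAt-skip : ∀ ma mb a b e cs → ((∀ a' → ma ≡ just a' → a' ≢ a) ⊎ (∀ b' → mb ≡ just b' → b' ≢ b)) →
  cellAt ma mb ((a , b , e) ∷ cs) ≡ cellAt ma mb cs
cellAt-skip nothing mb a b e cs _ = refl
cellAt-skip (just a') nothing a b e cs _ = refl
cellAt-skip (just a') (just b') a b e cs (inj₁ a'≢) rewrite ≡ᵇ-false (a'≢ a' refl) = refl
cellAt-skip (just a') (just b') a b e cs (inj₂ b'≢) rewrite ≡ᵇ-false (b'≢ b' refl) | ∧-zeroʳ (a' ≡ᵇ a) = refl

at-reverse-middle : ∀ (X : List ℕ) a Y → at (reverse (X ++ a ∷ Y)) (length Y) ≡ just a
at-reverse-middle X a Y rewrite reverse-middle X a Y | sym (length-reverse Y) = at-++-length (reverse Y) a (reverse X)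

Unique-reverse : ∀ xs → Unique xs → Unique (reverse xs)
Unique-reverse [] [] = []
Unique-reverse (x ∷ xs) (x∉ ∷ u) rewrite unfold-reverse x xs =
  AllPairs.++⁺ (Unique-reverse xs u) ([] ∷ []) (All-reverse xs (All.map (λ x≢y → (x≢y ∘ sym) ∷ []) x∉))

-- The invariant: P(v) is the tableau of the pattern, Q(v) holds the cells of Tab

module Invariant (A B : List ℕ) (uniqueA : Unique A) (uniqueB : Unique B) where
  open Crossings A

  rowValues : List ℕ
  rowValues = reverse A

  cellsFrom : List ℕ → List ℕ → List (ℕ × ℕ × ℕ)
  cellsFrom τ v = labelFrom (length v) (map (orient A) (swapPairs τ v))

  -- the filling with rows indexed by all of reverse A and columns by all of B
  fullTab : List ℕ → List ℕ → ℕ → ℕ → Maybe ℕ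
  fullTab τ v i j = cellAt (at rowValues i) (at B j) (cellsFrom τ v)

  Indexed : ℕ × ℕ × ℕ → Set
  Indexed (a , b , _) = (∃ λ i → at rowValues i ≡ just a) × (∃ λ j → at B j ≡ just b)

  Holds : List ℕ → List ℕ → Set
  Holds τ v = (Pw v ≡ patternTableau (map inA τ)) × (∀ i j → entry (Qw v) i j ≡ fullTab τ v i j)
            × All Indexed (cellsFrom τ v)

  module Step (τ₁ : List ℕ) (b a : ℕ) (τ₂ v : List ℕ) (b∉A : inA b ≡ false) (a∈A : inA a ≡ true)
              (onA : filterᵇ inA (τ₁ ++ b ∷ a ∷ τ₂) ≡ A) (offA : filterᵇ notA (τ₁ ++ b ∷ a ∷ τ₂) ≡ B) where
    x e : ℕ
    x = suc (length τ₁)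
    e = suc (length v)
    τ τ' : List ℕ
    τ = τ₁ ++ b ∷ a ∷ τ₂
    τ' = τ₁ ++ a ∷ b ∷ τ₂
    open Exchange (map inA τ₁) (map inA τ₂)

    patternBefore : map inA τ ≡ map inA τ₁ ++ false ∷ true ∷ map inA τ₂
    patternBefore = trans (map-++ inA τ₁ (b ∷ a ∷ τ₂)) (cong (map inA τ₁ ++_) (cong₂ _∷_ b∉A (cong₂ _∷_ a∈A refl)))

    patternAfter : map inA τ' ≡ map inA τ₁ ++ true ∷ false ∷ map inA τ₂
    patternAfter = trans (map-++ inA τ₁ (a ∷ b ∷ τ₂)) (cong (map inA τ₁ ++_) (cong₂ _∷_ a∈A (cong₂ _∷_ b∉A refl)))

    x≡p : x ≡ p
    x≡p = cong suc (sym (length-map inA τ₁))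

    newCell : cellsFrom τ (x ∷ v) ≡ (a , b , e) ∷ cellsFrom τ' v
    newCell rewrite nth-split₁ τ₁ b a τ₂ | nth-split₂ τ₁ b a τ₂ | swapAt-split τ₁ b a τ₂ | b∉A = refl

    rowOf-a : at rowValues (length Qhi) ≡ just a
    rowOf-a = begin
      at (reverse A) (length Qhi)
        ≡⟨ cong₂ (λ L k → at (reverse L) k) (sym onA) (trans (length-reverse (truePositions (suc (suc p)) (map inA τ₂))) (length-truePositions (suc (suc p)) inA τ₂)) ⟩
      at (reverse (filterᵇ inA τ)) (length (filterᵇ inA τ₂))
        ≡⟨ cong (λ L → at (reverse L) _) (trans (filterᵇ-++ inA τ₁ (b ∷ a ∷ τ₂))
             (cong (filterᵇ inA τ₁ ++_) (trans (filterᵇ-reject inA (a ∷ τ₂) b∉A) (filterᵇ-accept inA τ₂ a∈A)))) ⟩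
      at (reverse (filterᵇ inA τ₁ ++ a ∷ filterᵇ inA τ₂)) (length (filterᵇ inA τ₂))
        ≡⟨ at-reverse-middle (filterᵇ inA τ₁) a (filterᵇ inA τ₂) ⟩
      just a ∎
      where open ≡-Reasoning

    columnOf-b : at B (length lo) ≡ just b
    columnOf-b = begin
      at B (length lo)
        ≡⟨ cong₂ at (sym offA) (length-falsePositions 1 inA τ₁) ⟩
      at (filterᵇ notA τ) (length (filterᵇ notA τ₁))
        ≡⟨ cong (λ L → at L _) (trans (filterᵇ-++ notA τ₁ (b ∷ a ∷ τ₂))
             (cong (filterᵇ notA τ₁ ++_) (trans (filterᵇ-accept notA (a ∷ τ₂) (cong not b∉A))
               (cong (b ∷_) (filterᵇ-reject notA τ₂ (cong not a∈A)))))) ⟩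
      at (filterᵇ notA τ₁ ++ b ∷ filterᵇ notA τ₂) (length (filterᵇ notA τ₁))
        ≡⟨ at-++-length (filterᵇ notA τ₁) b (filterᵇ notA τ₂) ⟩
      just b ∎
      where open ≡-Reasoning

    holds : Holds τ' v → Holds τ (x ∷ v)
    holds (P≡ , entries , indexed) rewrite EG-∷ x v = P'≡ , entries' , indexed'
      where
      inserted : egInsert x (Pw v) ≡ (patternTableau (map inA τ) , length Qhi)
      inserted = begin
        egInsert x (Pw v)                                                    ≡⟨ cong₂ egInsert x≡p (trans P≡ (cong patternTableau patternAfter)) ⟩
        egInsert p (patternTableau (map inA τ₁ ++ true ∷ false ∷ map inA τ₂)) ≡⟨ exchange-insert ⟩
        (patternTableau (map inA τ₁ ++ false ∷ true ∷ map inA τ₂) , length Qhi) ≡⟨ cong (λ s → patternTableau s , length Qhi) (sym patternBefore) ⟩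
        (patternTableau (map inA τ) , length Qhi) ∎
        where open ≡-Reasoning
      P'≡ : proj₁ (egInsert x (Pw v)) ≡ patternTableau (map inA τ)
      P'≡ = cong proj₁ inserted
      slot : BoxSlot (map length (Qw v)) (length Qhi) (length lo)
      slot = subst (λ L → BoxSlot L (length Qhi) (length lo))
        (sym (trans (EG-shape v) (cong (map length) (trans P≡ (cong patternTableau patternAfter))))) exchange-box
      entries' : ∀ i j → entry (addBox (proj₂ (egInsert x (Pw v))) e (Qw v)) i j ≡ fullTab τ (x ∷ v) i j
      entries' i j rewrite cong proj₂ inserted | newCell with i ≟ length Qhi | j ≟ length lo
      ... | yes refl | yes refl = trans (addBox-new (Qw v) _ _ e slot)
        (sym (trans (cong₂ (λ m n → cellAt m n ((a , b , e) ∷ cellsFrom τ' v)) rowOf-a columnOf-b) (cellAt-here a b e (cellsFrom τ' v))))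
      ... | no i≢ | _ = trans (addBox-old (Qw v) _ _ e i j slot (inj₁ i≢)) (trans (entries i j)
        (sym (cellAt-skip (at rowValues i) (at B j) a b e _ (inj₁ λ a' at≡ a'≡a →
          i≢ (at-injective rowValues i _ a (Unique-reverse A uniqueA) (subst (λ z → at rowValues i ≡ just z) a'≡a at≡) rowOf-a)))))
      ... | yes _ | no j≢ = trans (addBox-old (Qw v) _ _ e i j slot (inj₂ j≢)) (trans (entries i j)
        (sym (cellAt-skip (at rowValues i) (at B j) a b e _ (inj₂ λ b' at≡ b'≡b →
          j≢ (at-injective B j _ b uniqueB (subst (λ z → at B j ≡ just z) b'≡b at≡) columnOf-b)))))
      indexed' : All Indexed (cellsFrom τ (x ∷ v))
      indexed' rewrite newCell = ((_ , rowOf-a) , (_ , columnOf-b)) ∷ indexed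

  holds : ∀ {τ v} → CrossingWord τ v → filterᵇ inA τ ≡ A → filterᵇ notA τ ≡ B →
          patternTableau (map inA (act τ v)) ≡ [] → Holds τ v
  holds done onA offA empty = sym empty , (λ i j → sym (cellAt-[] (at rowValues i) (at B j))) , []
  holds (step {v} τ₁ b a τ₂ b∉A a∈A cw) onA offA empty =
    Step.holds τ₁ b a τ₂ v b∉A a∈A onA offA (holds cw onA' offA' empty')
    where
    onA' : filterᵇ inA (τ₁ ++ a ∷ b ∷ τ₂) ≡ A
    onA' = trans (filterᵇ-swap inA τ₁ a b τ₂ (inj₂ b∉A)) onA
    offA' : filterᵇ notA (τ₁ ++ a ∷ b ∷ τ₂) ≡ B
    offA' = trans (filterᵇ-swap notA τ₁ a b τ₂ (inj₁ (cong not a∈A))) offA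
    empty' : patternTableau (map inA (act (τ₁ ++ a ∷ b ∷ τ₂) v)) ≡ []
    empty' = subst (λ z → patternTableau (map inA (act z v)) ≡ []) (swapAt-split τ₁ b a τ₂) empty

keep : (ℕ → Bool) → Maybe ℕ → Maybe ℕ
keep p (just x) = if p x then just x else nothing
keep p nothing = nothing

InitialSegment : (ℕ → Bool) → List ℕ → Set
InitialSegment p L = ∀ i j x → j ≤ i → at L i ≡ just x → p x ≡ true → ∃ λ y → (at L j ≡ just y) × (p y ≡ true)

initialSegment-head : ∀ p x L → p x ≡ false → InitialSegment p (x ∷ L) → ∀ i y → at L i ≡ just y → p y ≡ false
initialSegment-head p x L px seg i y at≡ with p y in py
... | false = refl
... | true with seg (suc i) 0 y z≤n at≡ py
...   | (_ , refl , px') = contradiction (trans (sym px) px') λ ()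

filterᵇ-none-at : ∀ (p : ℕ → Bool) L → (∀ i y → at L i ≡ just y → p y ≡ false) → filterᵇ p L ≡ []
filterᵇ-none-at p [] _ = refl
filterᵇ-none-at p (x ∷ L) fails = trans (filterᵇ-reject p L (fails 0 x refl)) (filterᵇ-none-at p L (fails ∘ suc))

filterᵇ-initial : ∀ (p : ℕ → Bool) L → InitialSegment p L → ∀ i → at (filterᵇ p L) i ≡ keep p (at L i)
filterᵇ-initial p [] seg i = refl
filterᵇ-initial p (x ∷ L) seg zero with p x in px
... | true = refl
... | false rewrite filterᵇ-none-at p L (initialSegment-head p x L px seg) = refl
filterᵇ-initial p (x ∷ L) seg (suc i) with p x in px
... | true = filterᵇ-initial p L (λ i j y j≤i → seg (suc i) (suc j) y (s≤s j≤i)) i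
... | false rewrite filterᵇ-none-at p L (initialSegment-head p x L px seg) = dropped
  where
  dropped : nothing ≡ keep p (at L i)
  dropped with at L i in at≡
  ... | nothing = refl
  ... | just y rewrite initialSegment-head p x L px seg i y at≡ = refl

inRows inColumns : ℕ → List (ℕ × ℕ × ℕ) → Bool
inRows a cs = any (λ c → a ≡ᵇ proj₁ c) cs
inColumns b cs = any (λ c → b ≡ᵇ proj₁ (proj₂ c)) cs

findCell-notInRows : ∀ a b cs → inRows a cs ≡ false → findCell a b cs ≡ nothing
findCell-notInRows a b [] _ = refl
findCell-notInRows a b ((a' , b' , e) ∷ cs) absent with a ≡ᵇ a'
... | false = findCell-notInRows a b cs absent

findCell-notInColumns : ∀ a b cs → inColumns b cs ≡ false → findCell a b cs ≡ nothing
findCell-notInColumns a b [] _ = refl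
findCell-notInColumns a b ((a' , b' , e) ∷ cs) absent with b ≡ᵇ b'
... | false rewrite ∧-zeroʳ (a ≡ᵇ a') = findCell-notInColumns a b cs absent

findCell-inRows : ∀ a b cs → Filled (findCell a b cs) → inRows a cs ≡ true
findCell-inRows a b [] (_ , ())
findCell-inRows a b ((a' , b' , e) ∷ cs) found with a ≡ᵇ a'
... | true = refl
... | false = findCell-inRows a b cs found

findCell-inColumns : ∀ a b cs → Filled (findCell a b cs) → inColumns b cs ≡ true
findCell-inColumns a b [] (_ , ())
findCell-inColumns a b ((a' , b' , e) ∷ cs) found with b ≡ᵇ b' | a ≡ᵇ a'
... | true | _ = refl
... | false | true = findCell-inColumns a b cs found
... | false | false = findCell-inColumns a b cs found

cellAt-filled : ∀ ma mb cs → Filled (cellAt ma mb cs) → ∃ λ a → ∃ λ b → (ma ≡ just a) × (mb ≡ just b) × Filled (findCell a b cs)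
cellAt-filled (just a) (just b) cs found = a , b , refl , refl , found
cellAt-filled (just a) nothing cs (_ , ())
cellAt-filled nothing mb cs (_ , ())

cellAt-keep : ∀ ma mb cs → cellAt (keep (λ a → inRows a cs) ma) (keep (λ b → inColumns b cs) mb) cs ≡ cellAt ma mb cs
cellAt-keep nothing mb cs = refl
cellAt-keep (just a) mb cs with inRows a cs in rows
... | false = sym (noRow mb)
  where
  noRow : ∀ mb → cellAt (just a) mb cs ≡ nothing
  noRow nothing = refl
  noRow (just b) = findCell-notInRows a b cs rows
... | true with mb
...   | nothing = refl
...   | just b with inColumns b cs in columns
...     | true = refl
...     | false = sym (findCell-notInColumns a b cs columns)

module Discard (A B : List ℕ) (uniqueA : Unique A) (uniqueB : Unique B) where
  open Crossings A
  open Invariant A B uniqueA uniqueB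

  inRows-cell : ∀ a cs → inRows a cs ≡ true → All Indexed cs → ∃ λ j → ∃ λ b → (at B j ≡ just b) × Filled (findCell a b cs)
  inRows-cell a [] () _
  inRows-cell a ((a' , b' , e) ∷ cs) present (((_ , _) , (j , atB)) ∷ indexed) with a ≡ᵇ a'
  ... | true = j , b' , atB , e , cong (λ t → if t then just e else findCell a b' cs) (≡ᵇ-refl b')
  ... | false = inRows-cell a cs present indexed

  inColumns-cell : ∀ b cs → inColumns b cs ≡ true → All Indexed cs → ∃ λ i → ∃ λ a → (at rowValues i ≡ just a) × Filled (findCell a b cs)
  inColumns-cell b [] () _
  inColumns-cell b ((a' , b' , e) ∷ cs) present (((i , atA) , (_ , _)) ∷ indexed) with b ≡ᵇ b'
  ... | true = i , a' , atA , e , cong (λ t → if t ∧ true then just e else findCell a' b cs) (≡ᵇ-refl a')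
  ... | false with inColumns-cell b cs present indexed
  ...   | (i' , a , atA' , (e' , found)) =
    i' , a , atA' , e' , trans (cong (λ t → if t then just e else findCell a b cs) (∧-zeroʳ (a ≡ᵇ a'))) found

  discard-empty : ∀ τ v → Holds τ v → ∀ i j →
    cellAt (at (filterᵇ (λ a → inRows a (cellsFrom τ v)) rowValues) i)
           (at (filterᵇ (λ b → inColumns b (cellsFrom τ v)) B) j) (cellsFrom τ v)
      ≡ entry (Qw v) i j
  discard-empty τ v (P≡ , entries , indexed) i j =
    trans (cong₂ (λ m n → cellAt m n cs) (filterᵇ-initial _ rowValues rowsInitial i) (filterᵇ-initial _ B columnsInitial j))
      (trans (cellAt-keep (at rowValues i) (at B j) cs) (sym (entries i j)))
    where
    cs : List (ℕ × ℕ × ℕ)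
    cs = cellsFrom τ v
    nonempty : All (0 <_) (map length (Qw v))
    nonempty = subst (All (0 <_)) (sym (trans (EG-shape v) (cong (map length) P≡)))
      (rowsBelow-nonempty 0 (falsePositions 1 (map inA τ)) (reverse (truePositions 1 (map inA τ))))
    rowsInitial : InitialSegment (λ a → inRows a cs) rowValues
    rowsInitial i i₀ x i₀≤i at≡ present with inRows-cell x cs present indexed
    ... | (j , b , atB , found) with cellAt-filled (at rowValues i₀) (at B 0) cs
          (subst Filled (entries i₀ 0) (filled-up (Qw v) i j i₀ nonempty
            (subst Filled (sym (entries i j)) (subst Filled (sym (cong₂ (λ m n → cellAt m n cs) at≡ atB)) found)) i₀≤i))
    ...   | (y , _ , at₀ , _ , found₀) = y , at₀ , findCell-inRows y _ cs found₀
    columnsInitial : InitialSegment (λ b → inColumns b cs) B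
    columnsInitial j j₀ x j₀≤j at≡ present with inColumns-cell x cs present indexed
    ... | (i , a , atA , found) with cellAt-filled (at rowValues i) (at B j₀) cs
          (subst Filled (entries i j₀) (filled-left (Qw v) i j j₀
            (subst Filled (sym (entries i j)) (subst Filled (sym (cong₂ (λ m n → cellAt m n cs) atA at≡)) found)) j₀≤j))
    ...   | (_ , y , _ , at₀ , found₀) = y , at₀ , findCell-inColumns _ y cs found₀

elemᵇ-self : ∀ L → All (λ a → elemᵇ a L ≡ true) L
elemᵇ-self [] = []
elemᵇ-self (y ∷ L) = cong (_∨ elemᵇ y L) (≡ᵇ-refl y)
  ∷ All.map (λ {a} a∈ → trans (cong ((a ≡ᵇ y) ∨_) a∈) (∨-zeroʳ (a ≡ᵇ y))) (elemᵇ-self L)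

elemᵇ-absent : ∀ b L → All (_≢ b) L → elemᵇ b L ≡ false
elemᵇ-absent b [] [] = refl
elemᵇ-absent b (x ∷ L) (x≢b ∷ rest) = cong₂ _∨_ (≡ᵇ-false (x≢b ∘ sym)) (elemᵇ-absent b L rest)

Unique-++-disjoint : ∀ (xs ys : List ℕ) → Unique (xs ++ ys) → All (λ y → All (_≢ y) xs) ys
Unique-++-disjoint [] ys _ = All.universal (λ _ → []) ys
Unique-++-disjoint (x ∷ xs) ys (x∉ ∷ u) =
  All.zipWith (λ (x≢y , xs≢y) → x≢y ∷ xs≢y) (All.++⁻ʳ xs x∉ , Unique-++-disjoint xs ys u)

module GrassmannianWord (n : ℕ) (w : List ℕ) (reduced : Reduced n w) (grassmannian : Grassmannian (perm n w)) where
  σ A B : List ℕ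
  σ = perm n w
  A = take (descentPos σ) σ
  B = drop (descentPos σ) σ
  open Crossings A

  σ≡A++B : A ++ B ≡ σ
  σ≡A++B = take++drop≡id (descentPos σ) σ

  uniqueσ : Unique σ
  uniqueσ = Unique-act (idPerm n) w (idPerm-unique n)

  uniqueA : Unique A
  uniqueA = Unique.take⁺ (descentPos σ) uniqueσ

  uniqueB : Unique B
  uniqueB = Unique.drop⁺ (descentPos σ) uniqueσ

  A⊆A : All (λ a → inA a ≡ true) A
  A⊆A = elemᵇ-self A

  B∩A : All (λ b → inA b ≡ false) B
  B∩A = All.map (λ {b} → elemᵇ-absent b A) (Unique-++-disjoint A B (subst Unique (sym σ≡A++B) uniqueσ))

  -- the identity has no crossings, σ has inv(σ) = |w| of them: every letter crosses
  crossingWord-w : CrossingWord (idPerm n) w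
  crossingWord-w = crossingWord (idPerm n) w (begin
    crossings σ                     ≡⟨ cong crossings (sym σ≡A++B) ⟩
    crossings (A ++ B)              ≡⟨ crossings-inversions A B (proj₁ increasing) (proj₂ increasing) A⊆A B∩A ⟩
    inversions (A ++ B)             ≡⟨ cong inversions σ≡A++B ⟩
    inversions σ                    ≡⟨ reduced ⟩
    length w                        ≡⟨ cong (_+ length w) (sym (crossings-increasing (idPerm n) (idPerm-increasing n))) ⟩
    crossings (idPerm n) + length w ∎)
    where
    open ≡-Reasoning
    increasing : AllPairs _≤_ A × AllPairs _≤_ B
    increasing = grassmannian-increasing σ grassmannian

  sides : (filterᵇ inA (idPerm n) ≡ A) × (filterᵇ notA (idPerm n) ≡ B)
  sides = trans (sym (proj₁ (crossingWord-filter crossingWord-w))) (subst (λ τ → filterᵇ inA τ ≡ A) σ≡A++B onA)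
        , trans (sym (proj₂ (crossingWord-filter crossingWord-w))) (subst (λ τ → filterᵇ notA τ ≡ B) σ≡A++B offA)
    where
    onA : filterᵇ inA (A ++ B) ≡ A
    onA = trans (filterᵇ-++ inA A B) (trans (cong₂ _++_ (filterᵇ-all inA A A⊆A) (filterᵇ-none inA B B∩A)) (++-identityʳ A))
    offA : filterᵇ notA (A ++ B) ≡ B
    offA = trans (filterᵇ-++ notA A B)
      (cong₂ _++_ (filterᵇ-none notA A (All.map (cong not) A⊆A)) (filterᵇ-all notA B (All.map (cong not) B∩A)))

  σ-tableau : patternTableau (map inA σ) ≡ []
  σ-tableau = subst (λ τ → patternTableau (map inA τ) ≡ []) σ≡A++B
    (trans (cong patternTableau (map-++ inA A B)) (patternTableau-sorted _ _ (All.map⁺ A⊆A) (All.map⁺ B∩A)))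

lemma4p1 : (n : ℕ) (w : List ℕ) → All (λ k → 1 ≤ k × k < n) w →
    Reduced n w → Grassmannian (perm n w) →
    (i j : ℕ) → tabCell n w i j ≡ qCell w i j
lemma4p1 n w _ reduced grassmannian i j = begin
  tabCell n w i j           ≡⟨ discard-empty (idPerm n) w invariant i j ⟩
  entry (Qw w) i j          ≡⟨ sym (qCell-entry w i j) ⟩
  qCell w i j               ∎
  where
  open ≡-Reasoning
  open GrassmannianWord n w reduced grassmannian
  open Invariant A B uniqueA uniqueB using (Holds; holds)
  open Discard A B uniqueA uniqueB using (discard-empty)
  invariant : Holds (idPerm n) w
  invariant = holds crossingWord-w (proj₁ sides) (proj₂ sides) σ-tableau
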